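{- Let $P$ be a bounded quasisemilattice and let $F\subseteq P$ be a finite nonempty set. Then the set of common lower bounds $\{r\in P: r\leq p\text{ for all }p\in F\}$ has only finitely many maximal elements.
   Context: A quasisemilattice (qsl) is a poset $P$ such that for any $p,q\in P$ the set of common lower bounds $\{r: r\leq p, r\leq q\}$ has only finitely many maximal elements and every common lower bound lies below at least one of these maximal elements. A qsl is bounded (a bqsl) if it has a minimum element. -}

module Defs where

open import Level using (Level; _⊔_)
open import Data.Product using (Σ; _×_; ∃)
open import Data.List using (List)
open import Data.List.NonEmpty using (List⁺; toList)
open import Data.List.Relation.Unary.All using (All)
open import Data.List.Relation.Unary.Any using (Any)
open import Relation.Binary.Bundles using (Poset)

module _ {c ℓ₁ ℓ₂ : Level} (P : Poset c ℓ₁ ℓ₂) where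
  open Poset P

  IsMaximal : (S : Carrier → Set (c ⊔ ℓ₂)) → Carrier → Set (c ⊔ ℓ₁ ⊔ ℓ₂)
  IsMaximal S m = S m × (∀ r → S r → m ≤ r → r ≈ m)

  FinitelyManyMaximal : (S : Carrier → Set (c ⊔ ℓ₂)) → Set (c ⊔ ℓ₁ ⊔ ℓ₂)
  FinitelyManyMaximal S =
    Σ (List Carrier) λ L → ∀ m → IsMaximal S m → Any (m ≈_) L

  CommonLowerBound : List Carrier → Carrier → Set (c ⊔ ℓ₂)
  CommonLowerBound F r = All (r ≤_) F

  LowerBound₂ : Carrier → Carrier → Carrier → Set (c ⊔ ℓ₂)
  LowerBound₂ p q r = Lift' (r ≤ p × r ≤ q)
    where
    Lift' : Set ℓ₂ → Set (c ⊔ ℓ₂)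
    Lift' A = Level.Lift (c ⊔ ℓ₂) A

  IsQSL : Set (c ⊔ ℓ₁ ⊔ ℓ₂)
  IsQSL = ∀ p q →
    FinitelyManyMaximal (LowerBound₂ p q)
    × (∀ r → LowerBound₂ p q r → ∃ λ m → IsMaximal (LowerBound₂ p q) m × r ≤ m)

  HasMinimum : Set (c ⊔ ℓ₂)
  HasMinimum = ∃ λ b → ∀ x → b ≤ x

  IsBQSL : Set (c ⊔ ℓ₁ ⊔ ℓ₂)
  IsBQSL = IsQSL × HasMinimum

{-# OPTIONS --safe #-}
module Submission where

-- In a quasisemilattice every pair p, q has a finite list of maximal common
-- lower bounds below one of which every common lower bound lies. Folding this
-- over F = p₁, …, pₙ (starting from the singleton list p₁) yields a finite
-- list C of common lower bounds of F such that every common lower bound of F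
-- lies below a member of C. A maximal common lower bound is then equivalent to
-- the member of C above it, so C lists all of them.

open import Defs
open import Level using (Level; _⊔_; lift)
open import Data.List using (List; []; _∷_; [_]; concatMap)
open import Data.List.NonEmpty using (List⁺; toList; _∷_)
open import Data.List.Relation.Unary.All as All using ([]; _∷_)
open import Data.List.Relation.Unary.Any as Any using (Any; here)
open import Data.List.Relation.Unary.Any.Properties using (concatMap⁺)
open import Data.Product using (Σ; _×_; _,_; proj₁; proj₂)
open import Relation.Binary.Bundles using (Poset)

module _ {c ℓ₁ ℓ₂ : Level} (P : Poset c ℓ₁ ℓ₂) where
  open Poset P

  IsCofinal : {s : Level} → (Carrier → Set s) → List Carrier → Set (c ⊔ ℓ₂ ⊔ s)
  IsCofinal S C = ∀ r → S r → Any (λ x → r ≤ x × S x) C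

  cofinal⇒finitelyManyMaximal : {S : Carrier → Set (c ⊔ ℓ₂)} {C : List Carrier} →
                                IsCofinal S C → FinitelyManyMaximal P S
  cofinal⇒finitelyManyMaximal {C = C} cofinal = C , λ m (Sm , maximal) →
    Any.map (λ (m≤x , Sx) → Eq.sym (maximal _ Sx m≤x)) (cofinal m Sm)

  singleton-cofinal : ∀ p → IsCofinal (CommonLowerBound P [ p ]) [ p ]
  singleton-cofinal p r (r≤p ∷ []) = here (r≤p , refl ∷ [])

module _ {c ℓ₁ ℓ₂ : Level} (P : Poset c ℓ₁ ℓ₂) (isQSL : IsQSL P) where
  open Poset P

  maximalLowerBounds : Carrier → Carrier → List Carrier
  maximalLowerBounds p q = proj₁ (proj₁ (isQSL p q))

  maximalLowerBounds-cofinal : ∀ p q → IsCofinal P (LowerBound₂ P p q) (maximalLowerBounds p q)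
  maximalLowerBounds-cofinal p q r r≤p,q with proj₂ (isQSL p q) r r≤p,q
  ... | m , m-maximal@(lift (m≤p , m≤q) , _) , r≤m =
    Any.map (λ m≈x → trans r≤m (reflexive m≈x) , lift (below m≈x m≤p , below m≈x m≤q))
            (proj₂ (proj₁ (isQSL p q)) m m-maximal)
    where
    below : ∀ {x y} → m ≈ x → m ≤ y → x ≤ y
    below m≈x = trans (reflexive (Eq.sym m≈x))

  cons-cofinal : ∀ p {F C} → IsCofinal P (CommonLowerBound P F) C →
                 IsCofinal P (CommonLowerBound P (p ∷ F)) (concatMap (maximalLowerBounds p) C)
  cons-cofinal p {F} cofinal r (r≤p ∷ r≤F) =
    concatMap⁺ (maximalLowerBounds p) (Any.map refine (cofinal r r≤F))
    where
    refine : ∀ {y} → r ≤ y × CommonLowerBound P F y →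
             Any (λ x → r ≤ x × CommonLowerBound P (p ∷ F) x) (maximalLowerBounds p y)
    refine (r≤y , y≤F) = Any.map
      (λ (r≤x , lift (x≤p , x≤y)) → r≤x , x≤p ∷ All.map (trans x≤y) y≤F)
      (maximalLowerBounds-cofinal p _ r (lift (r≤p , r≤y)))

  commonLowerBounds-cofinal : ∀ p F → Σ (List Carrier) (IsCofinal P (CommonLowerBound P (p ∷ F)))
  commonLowerBounds-cofinal p [] = [ p ] , singleton-cofinal P p
  commonLowerBounds-cofinal p (q ∷ F) =
    let C , cofinal = commonLowerBounds-cofinal q F
    in concatMap (maximalLowerBounds p) C , cons-cofinal p cofinal

mainTheorem7 : {c ℓ₁ ℓ₂ : Level} (P : Poset c ℓ₁ ℓ₂) → IsBQSL P →
    (F : List⁺ (Poset.Carrier P)) →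
    FinitelyManyMaximal P (CommonLowerBound P (toList F))
mainTheorem7 P (isQSL , _) (p ∷ F) =
  cofinal⇒finitelyManyMaximal P (proj₂ (commonLowerBounds-cofinal P isQSL p F))
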